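{- Let $p,q\ge1$ and let $\zeta$ be a $(p+q-1)$-th root of unity. Then $$D_{p,q}(\zeta)-D_{p-1,q}(\zeta)-D_{p,q-1}(\zeta)=D(p-1,q-1)\,\zeta^{ -1},$$ where $D(p-1,q-1)=|\mathcal{D}(p-1,q-1)|$ is the Delannoy number.
   Context: $\mathcal{D}(p,q)$ is the set of Delannoy paths from $(0,0)$ to $(p,q)$ in $\mathbb{N}^2$, using steps $E=(1,0)$, $N=(0,1)$, $D=(1,1)$. A step from $(a,b)$ to $(a+1,b)$ or $(a,b+1)$ has weight $1$; a diagonal step from $(a,b)$ to $(a+1,b+1)$ has weight $a+b+1$; the weight $\omega(L)$ of a path is the product of the weights of its steps. For $p,q\ge0$, $D_{p,q}(t):=\frac{1}{t}\sum_{L\in\mathcal{D}(p,q)}t^{\omega(L)}$. -}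

module Defs where

open import Level using (Level)
open import Data.Nat using (ℕ; zero; suc)
import Data.Nat as ℕ
import Data.Nat.Properties as ℕP
open import Data.Product using (_×_; _,_)
open import Data.Product.Properties using (≡-dec)
open import Data.List using (List; []; _∷_; map; concatMap; filter; length; upTo; foldr)
open import Relation.Binary.PropositionalEquality using (_≡_)
open import Algebra.Bundles using (CommutativeRing)

-- Steps of a Delannoy path: E = (1,0), N = (0,1), D = (1,1).
data Step : Set where
  E N D : Step

Word : Set
Word = List Step

endFrom : ℕ × ℕ → Word → ℕ × ℕ
endFrom pt          []       = pt
endFrom (a , b) (E ∷ w) = endFrom (suc a , b) w
endFrom (a , b) (N ∷ w) = endFrom (a , suc b) w
endFrom (a , b) (D ∷ w) = endFrom (suc a , suc b) w

endpoint : Word → ℕ × ℕ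
endpoint = endFrom (0 , 0)

weightFrom : ℕ × ℕ → Word → ℕ
weightFrom pt      []       = 1
weightFrom (a , b) (E ∷ w) = weightFrom (suc a , b) w
weightFrom (a , b) (N ∷ w) = weightFrom (a , suc b) w
weightFrom (a , b) (D ∷ w) = ((a ℕ.+ b) ℕ.+ 1) ℕ.* weightFrom (suc a , suc b) w

ω : Word → ℕ
ω = weightFrom (0 , 0)

wordsOfLength : ℕ → List Word
wordsOfLength zero    = [] ∷ []
wordsOfLength (suc n) = concatMap (λ s → map (s ∷_) (wordsOfLength n)) (E ∷ N ∷ D ∷ [])

-- 𝒟(p,q): all Delannoy paths from (0,0) to (p,q), i.e. all words (necessarily of
-- length ≤ p + q) whose walk from the origin ends at (p,q). Each appears exactly once.
delannoyPaths : ℕ → ℕ → List Word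
delannoyPaths p q =
  filter (λ w → ≡-dec ℕP._≟_ ℕP._≟_ (endpoint w) (p , q))
         (concatMap wordsOfLength (upTo (suc (p ℕ.+ q))))

delannoy : ℕ → ℕ → ℕ
delannoy p q = length (delannoyPaths p q)

module RingDefs {c ℓ : Level} (R : CommutativeRing c ℓ) where
  open CommutativeRing R

  pow : Carrier → ℕ → Carrier
  pow x zero    = 1#
  pow x (suc n) = x * pow x n

  fromℕ : ℕ → Carrier
  fromℕ zero    = 0#
  fromℕ (suc n) = 1# + fromℕ n

  pathSum : ℕ → ℕ → Carrier → Carrier
  pathSum p q t = foldr _+_ 0# (map (λ L → pow t (ω L)) (delannoyPaths p q))

  -- D_{p,q}(t) = (1/t) Σ_{L ∈ 𝒟(p,q)} t^{ω(L)}, where tInv is the inverse of t.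
  Dpoly : ℕ → ℕ → (t tInv : Carrier) → Carrier
  Dpoly p q t tInv = tInv * pathSum p q t

-- Proof idea: split the paths to (p,q) according to their last step.  A last
-- step E or N has weight 1, so those paths contribute exactly the path sums to
-- (p-1,q) and (p,q-1).  A last step D starts at (p-1,q-1) and has weight
-- p+q-1, so every such path has weight divisible by p+q-1 and contributes
-- ζ^ω = 1; together they contribute the Delannoy number D(p-1,q-1).
-- Multiplying by ζ⁻¹ gives the proposition.
module Submission where

open import Defs
open import Level using (Level)
open import Algebra.Bundles using (CommutativeMonoid; CommutativeRing)
open import Data.Nat using (ℕ; zero; suc)
open import Data.Product using (_×_; _,_)
open import Data.List using (List; []; _∷_; _∷ʳ_; map; length; foldr)
open import Data.List.Relation.Unary.All using (All; []; _∷_)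
open import Function using (_∘_)
open import Relation.Binary.PropositionalEquality as ≡ using (_≡_)
open import Relation.Unary using (Decidable)

module Walks where
  open import Data.Nat using (_+_; _*_; _≤_; s≤s)
  open import Data.Nat.Properties
    using (_≟_; +-suc; +-identityʳ; *-comm; *-assoc; ≤-refl; ≤-reflexive;
           n≤1+n; +-monoʳ-≤; +-monoˡ-≤; module ≤-Reasoning)
  open import Data.Product.Properties using (≡-dec)
  open import Data.List using (concatMap; upTo)
  import Data.List.Relation.Unary.All as All
  open import Data.List.Relation.Unary.All.Properties using (concat⁺; map⁺)
  open import Function using (_⇔_; mk⇔; module Equivalence)
  open ≡ using (refl; sym; trans; cong)

  move : ℕ × ℕ → Step → ℕ × ℕ
  move (a , b) E = suc a , b
  move (a , b) N = a , suc b
  move (a , b) D = suc a , suc b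

  stepWeight : ℕ × ℕ → Step → ℕ
  stepWeight _       E = 1
  stepWeight _       N = 1
  stepWeight (a , b) D = a + b + 1

  size : ℕ × ℕ → ℕ
  size (a , b) = a + b

  endFrom-∷ : ∀ pt s w → endFrom pt (s ∷ w) ≡ endFrom (move pt s) w
  endFrom-∷ (a , b) E w = refl
  endFrom-∷ (a , b) N w = refl
  endFrom-∷ (a , b) D w = refl

  endFrom-snoc : ∀ pt w s → endFrom pt (w ∷ʳ s) ≡ move (endFrom pt w) s
  endFrom-snoc (a , b) []      E = refl
  endFrom-snoc (a , b) []      N = refl
  endFrom-snoc (a , b) []      D = refl
  endFrom-snoc (a , b) (E ∷ w) s = endFrom-snoc (suc a , b) w s
  endFrom-snoc (a , b) (N ∷ w) s = endFrom-snoc (a , suc b) w s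
  endFrom-snoc (a , b) (D ∷ w) s = endFrom-snoc (suc a , suc b) w s

  weightFrom-snoc : ∀ pt w s →
    weightFrom pt (w ∷ʳ s) ≡ weightFrom pt w * stepWeight (endFrom pt w) s
  weightFrom-snoc (a , b) []      E = refl
  weightFrom-snoc (a , b) []      N = refl
  weightFrom-snoc (a , b) []      D = *-comm (a + b + 1) 1
  weightFrom-snoc (a , b) (E ∷ w) s = weightFrom-snoc (suc a , b) w s
  weightFrom-snoc (a , b) (N ∷ w) s = weightFrom-snoc (a , suc b) w s
  weightFrom-snoc (a , b) (D ∷ w) s =
    trans (cong ((a + b + 1) *_) (weightFrom-snoc (suc a , suc b) w s))
          (sym (*-assoc (a + b + 1) _ _))

  size-move : ∀ pt s → suc (size pt) ≤ size (move pt s)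
  size-move (a , b) E = ≤-refl
  size-move (a , b) N = ≤-reflexive (sym (+-suc a b))
  size-move (a , b) D = s≤s (+-monoʳ-≤ a (n≤1+n b))

  length-bound : ∀ pt w → size pt + length w ≤ size (endFrom pt w)
  length-bound pt []      = ≤-reflexive (+-identityʳ (size pt))
  length-bound pt (s ∷ w) = begin
    size pt + suc (length w)       ≡⟨ +-suc (size pt) (length w) ⟩
    suc (size pt) + length w       ≤⟨ +-monoˡ-≤ (length w) (size-move pt s) ⟩
    size (move pt s) + length w    ≤⟨ length-bound (move pt s) w ⟩
    size (endFrom (move pt s) w)   ≡⟨ cong size (endFrom-∷ pt s w) ⟨
    size (endFrom pt (s ∷ w))      ∎
    where open ≤-Reasoning

  back : Step → ℕ → ℕ → ℕ × ℕ
  back E x y = x , suc y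
  back N x y = suc x , y
  back D x y = x , y

  move-⇔-back : ∀ pt s x y → (move pt s ≡ (suc x , suc y)) ⇔ (pt ≡ back s x y)
  move-⇔-back (a , b) E x y = mk⇔ (λ { refl → refl }) (λ { refl → refl })
  move-⇔-back (a , b) N x y = mk⇔ (λ { refl → refl }) (λ { refl → refl })
  move-⇔-back (a , b) D x y = mk⇔ (λ { refl → refl }) (λ { refl → refl })

  endpoint-snoc-⇔ : ∀ w s x y → (endpoint (w ∷ʳ s) ≡ (suc x , suc y)) ⇔ (endpoint w ≡ back s x y)
  endpoint-snoc-⇔ w s x y = mk⇔
    (λ e → to   (trans (sym (endFrom-snoc (0 , 0) w s)) e))
    (λ e → trans (endFrom-snoc (0 , 0) w s) (from e))
    where open Equivalence (move-⇔-back (endpoint w) s x y)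

  size-back : ∀ s x y → size (back s x y) ≤ x + suc y
  size-back E x y = ≤-refl
  size-back N x y = ≤-reflexive (sym (+-suc x y))
  size-back D x y = +-monoʳ-≤ x (n≤1+n y)

  steps : List Step
  steps = E ∷ N ∷ D ∷ []

  wordsUpTo : ℕ → List Word
  wordsUpTo m = concatMap wordsOfLength (upTo (suc m))

  wordsOfLength-length : ∀ n → All (λ w → length w ≡ n) (wordsOfLength n)
  wordsOfLength-length zero    = refl ∷ []
  wordsOfLength-length (suc n) = concat⁺ (extend E ∷ extend N ∷ extend D ∷ [])
    where
    extend : ∀ s → All (λ w → length w ≡ suc n) (map (s ∷_) (wordsOfLength n))
    extend s = map⁺ (All.map (cong suc) (wordsOfLength-length n))

  endsAt? : (pt : ℕ × ℕ) → Decidable (λ w → endpoint w ≡ pt)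
  endsAt? pt w = ≡-dec _≟_ _≟_ (endpoint w) pt

  pathsTo : ℕ × ℕ → List Word
  pathsTo (a , b) = delannoyPaths a b

open Walks

module ListSum {c ℓ : Level} (M : CommutativeMonoid c ℓ) where
  open CommutativeMonoid M
  open import Algebra.Properties.CommutativeSemigroup commutativeSemigroup using (interchange)
  open import Data.Bool using (true; false; if_then_else_)
  open import Data.List using (_++_; concatMap; filter)
  open import Relation.Nullary using (does)

  ∑ : {A : Set} → List A → (A → Carrier) → Carrier
  ∑ xs g = foldr _∙_ ε (map g xs)

  syntax ∑ xs (λ x → g) = ∑[ x ∈ xs ] g

  ∑-cong : {A : Set} (xs : List A) {f g : A → Carrier} →
           (∀ x → f x ≈ g x) → ∑ xs f ≈ ∑ xs g
  ∑-cong []       e = refl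
  ∑-cong (x ∷ xs) e = ∙-cong (e x) (∑-cong xs e)

  ∑-cong-All : {A : Set} {P : A → Set} {xs : List A} {f g : A → Carrier} →
               All P xs → (∀ x → P x → f x ≈ g x) → ∑ xs f ≈ ∑ xs g
  ∑-cong-All []         e = refl
  ∑-cong-All (px ∷ pxs) e = ∙-cong (e _ px) (∑-cong-All pxs e)

  ∑-0 : {A : Set} (xs : List A) → ∑[ x ∈ xs ] ε ≈ ε
  ∑-0 []       = refl
  ∑-0 (x ∷ xs) = trans (identityˡ _) (∑-0 xs)

  ∑-map : {A B : Set} (h : A → B) (xs : List A) (g : B → Carrier) →
          ∑ (map h xs) g ≡ ∑ xs (g ∘ h)
  ∑-map h []       g = ≡.refl
  ∑-map h (x ∷ xs) g = ≡.cong (g (h x) ∙_) (∑-map h xs g)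

  ∑-++ : {A : Set} (xs ys : List A) (g : A → Carrier) → ∑ (xs ++ ys) g ≈ ∑ xs g ∙ ∑ ys g
  ∑-++ []       ys g = sym (identityˡ _)
  ∑-++ (x ∷ xs) ys g = trans (∙-congˡ (∑-++ xs ys g)) (sym (assoc _ _ _))

  ∑-concatMap : {A B : Set} (h : A → List B) (xs : List A) (g : B → Carrier) →
                ∑ (concatMap h xs) g ≈ ∑[ x ∈ xs ] ∑ (h x) g
  ∑-concatMap h []       g = refl
  ∑-concatMap h (x ∷ xs) g = trans (∑-++ (h x) _ g) (∙-congˡ (∑-concatMap h xs g))

  ∑-distrib : {A : Set} (xs : List A) (f g : A → Carrier) →
              ∑[ x ∈ xs ] (f x ∙ g x) ≈ ∑ xs f ∙ ∑ xs g
  ∑-distrib []       f g = sym (identityˡ ε)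
  ∑-distrib (x ∷ xs) f g =
    trans (∙-congˡ (∑-distrib xs f g)) (interchange (f x) (g x) (∑ xs f) (∑ xs g))

  ∑-comm : {A B : Set} (xs : List A) (ys : List B) (f : A → B → Carrier) →
           ∑[ x ∈ xs ] ∑[ y ∈ ys ] f x y ≈ ∑[ y ∈ ys ] ∑[ x ∈ xs ] f x y
  ∑-comm []       ys f = sym (∑-0 ys)
  ∑-comm (x ∷ xs) ys f =
    trans (∙-congˡ (∑-comm xs ys f)) (sym (∑-distrib ys (f x) (λ y → ∑[ x ∈ xs ] f x y)))

  restrict : {A : Set} {P : A → Set} → Decidable P → (A → Carrier) → A → Carrier
  restrict P? g x = if does (P? x) then g x else ε

  ∑-filter : {A : Set} {P : A → Set} (P? : Decidable P) (xs : List A) (g : A → Carrier) →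
             ∑ (filter P? xs) g ≈ ∑ xs (restrict P? g)
  ∑-filter P? []       g = refl
  ∑-filter P? (x ∷ xs) g with does (P? x)
  ... | true  = ∙-congˡ (∑-filter P? xs g)
  ... | false = trans (∑-filter P? xs g) (sym (identityˡ _))

module WordSum {c ℓ : Level} (M : CommutativeMonoid c ℓ) where
  open CommutativeMonoid M
  open ListSum M
  open import Relation.Binary.Reasoning.Setoid setoid
  open import Data.Nat using (_+_; _≤_; s≤s; _≤′_; ≤′-refl; ≤′-step)
  open import Data.Nat.Properties using (<⇒≱; ≤⇒≤′; ≤′⇒≤)
  open import Data.Bool using (if_then_else_)
  open import Data.List using (concatMap; upTo; applyUpTo)
  open import Data.List.Properties using (upTo-∷ʳ; map-upTo)
  open import Relation.Nullary using (¬_)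
  open import Relation.Nullary.Decidable using (does-⇔; dec-false)

  ∑-wordsOfLength-cons : ∀ n (g : Word → Carrier) →
    ∑ (wordsOfLength (suc n)) g ≈ ∑[ s ∈ steps ] ∑[ w ∈ wordsOfLength n ] g (s ∷ w)
  ∑-wordsOfLength-cons n g =
    trans (∑-concatMap (λ s → map (s ∷_) (wordsOfLength n)) steps g)
          (∑-cong steps λ s → reflexive (∑-map (s ∷_) (wordsOfLength n) g))

  ∑-wordsOfLength-snoc : ∀ n (g : Word → Carrier) →
    ∑ (wordsOfLength (suc n)) g ≈ ∑[ s ∈ steps ] ∑[ w ∈ wordsOfLength n ] g (w ∷ʳ s)
  ∑-wordsOfLength-snoc zero    g = ∑-wordsOfLength-cons zero g
  ∑-wordsOfLength-snoc (suc n) g = begin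
    ∑ (wordsOfLength (suc (suc n))) g
      ≈⟨ ∑-wordsOfLength-cons (suc n) g ⟩
    ∑[ s ∈ steps ] ∑[ w ∈ wordsOfLength (suc n) ] g (s ∷ w)
      ≈⟨ ∑-cong steps (λ s → ∑-wordsOfLength-snoc n (g ∘ (s ∷_))) ⟩
    ∑[ s ∈ steps ] ∑[ t ∈ steps ] ∑[ w ∈ wordsOfLength n ] g (s ∷ w ∷ʳ t)
      ≈⟨ ∑-comm steps steps (λ s t → ∑[ w ∈ wordsOfLength n ] g (s ∷ w ∷ʳ t)) ⟩
    ∑[ t ∈ steps ] ∑[ s ∈ steps ] ∑[ w ∈ wordsOfLength n ] g (s ∷ w ∷ʳ t)
      ≈⟨ ∑-cong steps (λ t → ∑-wordsOfLength-cons n (λ w → g (w ∷ʳ t))) ⟨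
    ∑[ t ∈ steps ] ∑[ w ∈ wordsOfLength (suc n) ] g (w ∷ʳ t) ∎

  ∑-wordsUpTo-snoc : ∀ m (g : Word → Carrier) →
    ∑ (wordsUpTo (suc m)) g ≈ g [] ∙ ∑[ s ∈ steps ] ∑[ w ∈ wordsUpTo m ] g (w ∷ʳ s)
  ∑-wordsUpTo-snoc m g = begin
    ∑ (wordsUpTo (suc m)) g
      ≈⟨ ∑-concatMap wordsOfLength (upTo (suc (suc m))) g ⟩
    (g [] ∙ ε) ∙ ∑[ n ∈ applyUpTo suc (suc m) ] ∑ (wordsOfLength n) g
      ≈⟨ ∙-cong (identityʳ (g [])) (reflexive (≡.cong (λ ns → ∑[ n ∈ ns ] ∑ (wordsOfLength n) g)
                                                       (≡.sym (map-upTo suc (suc m))))) ⟩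
    g [] ∙ ∑[ n ∈ map suc (upTo (suc m)) ] ∑ (wordsOfLength n) g
      ≈⟨ ∙-congˡ (reflexive (∑-map suc (upTo (suc m)) _)) ⟩
    g [] ∙ ∑[ n ∈ upTo (suc m) ] ∑ (wordsOfLength (suc n)) g
      ≈⟨ ∙-congˡ (∑-cong (upTo (suc m)) (λ n → ∑-wordsOfLength-snoc n g)) ⟩
    g [] ∙ ∑[ n ∈ upTo (suc m) ] ∑[ s ∈ steps ] ∑[ w ∈ wordsOfLength n ] g (w ∷ʳ s)
      ≈⟨ ∙-congˡ (∑-comm (upTo (suc m)) steps (λ n s → ∑[ w ∈ wordsOfLength n ] g (w ∷ʳ s))) ⟩
    g [] ∙ ∑[ s ∈ steps ] ∑[ n ∈ upTo (suc m) ] ∑[ w ∈ wordsOfLength n ] g (w ∷ʳ s)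
      ≈⟨ ∙-congˡ (∑-cong steps (λ s → ∑-concatMap wordsOfLength (upTo (suc m)) (g ∘ (_∷ʳ s)))) ⟨
    g [] ∙ ∑[ s ∈ steps ] ∑[ w ∈ wordsUpTo m ] g (w ∷ʳ s) ∎

  ∑-wordsUpTo-suc : ∀ m (g : Word → Carrier) →
    ∑ (wordsUpTo (suc m)) g ≈ ∑ (wordsUpTo m) g ∙ ∑ (wordsOfLength (suc m)) g
  ∑-wordsUpTo-suc m g = begin
    ∑ (wordsUpTo (suc m)) g
      ≡⟨ ≡.cong (λ ns → ∑ (concatMap wordsOfLength ns) g) (upTo-∷ʳ (suc m)) ⟨
    ∑ (concatMap wordsOfLength (upTo (suc m) ∷ʳ suc m)) g
      ≈⟨ ∑-concatMap wordsOfLength (upTo (suc m) ∷ʳ suc m) g ⟩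
    ∑[ n ∈ upTo (suc m) ∷ʳ suc m ] ∑ (wordsOfLength n) g
      ≈⟨ ∑-++ (upTo (suc m)) (suc m ∷ []) _ ⟩
    ∑[ n ∈ upTo (suc m) ] ∑ (wordsOfLength n) g ∙ (∑ (wordsOfLength (suc m)) g ∙ ε)
      ≈⟨ ∙-cong (sym (∑-concatMap wordsOfLength (upTo (suc m)) g)) (identityʳ _) ⟩
    ∑ (wordsUpTo m) g ∙ ∑ (wordsOfLength (suc m)) g ∎

  walkSum : ℕ → ℕ × ℕ → (Word → Carrier) → Carrier
  walkSum m pt F = ∑ (wordsUpTo m) (restrict (endsAt? pt) F)

  ∑-pathsTo : ∀ pt (F : Word → Carrier) → ∑ (pathsTo pt) F ≈ walkSum (size pt) pt F
  ∑-pathsTo (a , b) F = ∑-filter (endsAt? (a , b)) (wordsUpTo (a + b)) F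

  -- No word of length m + 1 ends at a point of coordinate sum ≤ m.
  walkSum-suc : ∀ m pt F → size pt ≤ m → walkSum (suc m) pt F ≈ walkSum m pt F
  walkSum-suc m pt F pt≤m = begin
    walkSum (suc m) pt F
      ≈⟨ ∑-wordsUpTo-suc m _ ⟩
    walkSum m pt F ∙ ∑ (wordsOfLength (suc m)) (restrict (endsAt? pt) F)
      ≈⟨ ∙-congˡ (∑-cong-All (wordsOfLength-length (suc m)) tooLong) ⟩
    walkSum m pt F ∙ ∑[ w ∈ wordsOfLength (suc m) ] ε
      ≈⟨ ∙-congˡ (∑-0 (wordsOfLength (suc m))) ⟩
    walkSum m pt F ∙ ε
      ≈⟨ identityʳ _ ⟩
    walkSum m pt F ∎
    where
    unreachable : ∀ w → length w ≡ suc m → ¬ (endpoint w ≡ pt)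
    unreachable w len ends =
      <⇒≱ (s≤s pt≤m) (≡.subst₂ _≤_ len (≡.cong size ends) (length-bound (0 , 0) w))

    tooLong : ∀ w → length w ≡ suc m → restrict (endsAt? pt) F w ≈ ε
    tooLong w len = reflexive (≡.cong (λ b → if b then F w else ε)
                                    (dec-false (endsAt? pt w) (unreachable w len)))

  walkSum-stable : ∀ m pt F → size pt ≤ m → walkSum m pt F ≈ walkSum (size pt) pt F
  walkSum-stable m pt F pt≤m = go (≤⇒≤′ pt≤m)
    where
    go : ∀ {n} → size pt ≤′ n → walkSum n pt F ≈ walkSum (size pt) pt F
    go ≤′-refl                = refl
    go {suc n} (≤′-step pt≤n) =
      trans (walkSum-suc n pt F (≤′⇒≤ pt≤n)) (go pt≤n)

  walkSum-last-step : ∀ m x y F →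
    walkSum (suc m) (suc x , suc y) F ≈ ∑[ s ∈ steps ] walkSum m (back s x y) (F ∘ (_∷ʳ s))
  walkSum-last-step m x y F = begin
    walkSum (suc m) (suc x , suc y) F
      ≈⟨ ∑-wordsUpTo-snoc m _ ⟩
    restrict (endsAt? (suc x , suc y)) F [] ∙ _
      ≈⟨ ∙-cong emptyWord (∑-cong steps λ s → ∑-cong (wordsUpTo m) (lastStep s)) ⟩
    ε ∙ ∑[ s ∈ steps ] walkSum m (back s x y) (F ∘ (_∷ʳ s))
      ≈⟨ identityˡ _ ⟩
    ∑[ s ∈ steps ] walkSum m (back s x y) (F ∘ (_∷ʳ s)) ∎
    where
    emptyWord : restrict (endsAt? (suc x , suc y)) F [] ≈ ε
    emptyWord = reflexive (≡.cong (λ b → if b then F [] else ε)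
                                (dec-false (endsAt? (suc x , suc y) []) λ ()))

    lastStep : ∀ s w → restrict (endsAt? (suc x , suc y)) F (w ∷ʳ s)
                     ≈ restrict (endsAt? (back s x y)) (F ∘ (_∷ʳ s)) w
    lastStep s w = reflexive (≡.cong (λ b → if b then F (w ∷ʳ s) else ε)
      (does-⇔ (endpoint-snoc-⇔ w s x y) (endsAt? _ (w ∷ʳ s)) (endsAt? _ w)))

  ∑-delannoy-last-step : ∀ x y F →
    ∑ (delannoyPaths (suc x) (suc y)) F ≈ ∑[ s ∈ steps ] ∑[ w ∈ pathsTo (back s x y) ] F (w ∷ʳ s)
  ∑-delannoy-last-step x y F = begin
    ∑ (delannoyPaths (suc x) (suc y)) F
      ≈⟨ ∑-pathsTo (suc x , suc y) F ⟩
    walkSum (suc (x + suc y)) (suc x , suc y) F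
      ≈⟨ walkSum-last-step (x + suc y) x y F ⟩
    ∑[ s ∈ steps ] walkSum (x + suc y) (back s x y) (F ∘ (_∷ʳ s))
      ≈⟨ ∑-cong steps (λ s → walkSum-stable (x + suc y) (back s x y) (F ∘ (_∷ʳ s)) (size-back s x y)) ⟩
    ∑[ s ∈ steps ] walkSum (size (back s x y)) (back s x y) (F ∘ (_∷ʳ s))
      ≈⟨ ∑-cong steps (λ s → ∑-pathsTo (back s x y) (F ∘ (_∷ʳ s))) ⟨
    ∑[ s ∈ steps ] ∑[ w ∈ pathsTo (back s x y) ] F (w ∷ʳ s) ∎

module AtRootOfUnity {c ℓ : Level} (R : CommutativeRing c ℓ) where
  open CommutativeRing R
  open RingDefs R
  open ListSum +-commutativeMonoid
  open WordSum +-commutativeMonoid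
  open import Data.List.Relation.Unary.All.Properties using (all-filter)
  import Data.Nat as ℕ
  import Data.Nat.Properties as ℕ
  open import Relation.Binary.Reasoning.Setoid setoid

  pow-+ : ∀ t m n → pow t (m ℕ.+ n) ≈ pow t m * pow t n
  pow-+ t zero    n = sym (*-identityˡ _)
  pow-+ t (suc m) n = trans (*-congˡ (pow-+ t m n)) (sym (*-assoc _ _ _))

  pow-root : ∀ t n → pow t n ≈ 1# → ∀ k → pow t (k ℕ.* n) ≈ 1#
  pow-root t n tⁿ≈1 zero    = refl
  pow-root t n tⁿ≈1 (suc k) =
    trans (pow-+ t n (k ℕ.* n)) (trans (*-cong tⁿ≈1 (pow-root t n tⁿ≈1 k)) (*-identityˡ 1#))

  ∑-1 : {A : Set} (xs : List A) → ∑[ x ∈ xs ] 1# ≈ fromℕ (length xs)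
  ∑-1 []       = refl
  ∑-1 (x ∷ xs) = +-congˡ (∑-1 xs)

  pathSum-recurrence : ∀ x y t → pow t (x ℕ.+ suc y) ≈ 1# →
    pathSum (suc x) (suc y) t
      ≈ pathSum x (suc y) t + (pathSum (suc x) y t + (fromℕ (delannoy x y) + 0#))
  pathSum-recurrence x y t root =
    trans (∑-delannoy-last-step x y (pow t ∘ ω))
          (+-cong (∑-cong (delannoyPaths x (suc y)) λ w → unitStep w E ≡.refl)
          (+-cong (∑-cong (delannoyPaths (suc x) y) λ w → unitStep w N ≡.refl)
          (+-cong (trans (∑-cong-All (all-filter (endsAt? (x , y)) (wordsUpTo (x ℕ.+ y))) diagonalStep)
                         (∑-1 (delannoyPaths x y)))
                  refl)))
    where
    unitStep : ∀ w s → stepWeight (endpoint w) s ≡ 1 → pow t (ω (w ∷ʳ s)) ≈ pow t (ω w)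
    unitStep w s weight1 = reflexive (≡.cong (pow t)
      (≡.trans (weightFrom-snoc (0 , 0) w s) (≡.trans (≡.cong (ω w ℕ.*_) weight1) (ℕ.*-identityʳ (ω w)))))

    root′ : pow t (x ℕ.+ y ℕ.+ 1) ≈ 1#
    root′ = trans (reflexive (≡.cong (pow t) (≡.trans (ℕ.+-assoc x y 1) (≡.cong (x ℕ.+_) (ℕ.+-comm y 1)))))
                  root

    -- The last diagonal step from (x, y) has weight x + y + 1.
    diagonalStep : ∀ w → endpoint w ≡ (x , y) → pow t (ω (w ∷ʳ D)) ≈ 1#
    diagonalStep w ≡.refl = trans
      (reflexive (≡.cong (pow t) (weightFrom-snoc (0 , 0) w D)))
      (pow-root t _ root′ (ω w))

  scale-recurrence : ∀ z a b c d → a ≈ b + (c + (d + 0#)) → (z * a - z * b) - z * c ≈ d * z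
  scale-recurrence z a b c d a≈ = begin
    (z * a - z * b) - z * c
      ≈⟨ +-congʳ (+-congʳ (*-congˡ (trans a≈ (+-congˡ (+-congˡ (+-identityʳ d)))))) ⟩
    (z * (b + (c + d)) - z * b) - z * c
      ≈⟨ +-congʳ (+-congʳ (trans (distribˡ z b (c + d)) (+-congˡ (distribˡ z c d)))) ⟩
    ((z * b + (z * c + z * d)) - z * b) - z * c
      ≈⟨ +-congʳ (xyx⁻¹≈y (z * b) _) ⟩
    (z * c + z * d) - z * c
      ≈⟨ xyx⁻¹≈y (z * c) (z * d) ⟩
    z * d
      ≈⟨ *-comm z d ⟩
    d * z ∎
    where open import Algebra.Properties.AbelianGroup +-abelianGroup using (xyx⁻¹≈y)

-- ℕ-arithmetic of the statement, opened only here so that it does not clash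
-- with the ring and monoid operations in the modules above.
open import Data.Nat using (ℕ; _+_; _∸_; _≤_)

proposition7p1 : ∀ {c ℓ : Level} (R : CommutativeRing c ℓ) (p q : ℕ) → 1 ≤ p → 1 ≤ q →
    ∀ (ζ ζ⁻¹ : CommutativeRing.Carrier R) →
    CommutativeRing._≈_ R (RingDefs.pow R ζ (p + q ∸ 1)) (CommutativeRing.1# R) →
    CommutativeRing._≈_ R (CommutativeRing._*_ R ζ ζ⁻¹) (CommutativeRing.1# R) →
    CommutativeRing._≈_ R
      (CommutativeRing._-_ R
        (CommutativeRing._-_ R (RingDefs.Dpoly R p q ζ ζ⁻¹) (RingDefs.Dpoly R (p ∸ 1) q ζ ζ⁻¹))
        (RingDefs.Dpoly R p (q ∸ 1) ζ ζ⁻¹))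
      (CommutativeRing._*_ R (RingDefs.fromℕ R (delannoy (p ∸ 1) (q ∸ 1))) ζ⁻¹)
proposition7p1 R (suc x) (suc y) _ _ ζ ζ⁻¹ root _ =
  scale-recurrence ζ⁻¹ _ _ _ _ (pathSum-recurrence x y ζ root)
  where open AtRootOfUnity R
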